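{- Let $\sigma$ be a partition of a positive integer $r$ with smallest part $\delta$, let $n,q$ be positive integers, let $H=H(n,r,q\mid\sigma)$, and let $\beta$ be an integer with $2 \leq s(\sigma) \leq \beta$ and $\delta \geq r - \beta + 1$. Then $H$ has no gap in its $(2,\beta)$-spectrum above the $(2,\beta)$-monochromatic zone; that is, for every integer $k$ with $n \le k \le \overline{\chi}_{2,\beta}(H)$, $H$ has a $k$-$(2,\beta)$-colouring.
   Context: For a partition $\sigma$ of $r$ and positive integers $n,q$, the $\sigma$-hypergraph $H(n,r,q\mid\sigma)$ is the $r$-uniform hypergraph whose vertex set has $nq$ vertices partitioned into $n$ classes $V_1,\dots,V_n$ of $q$ vertices each, and in which an $r$-subset $K$ of the vertex set is an edge if and only if the multiset of non-zero cardinalities $|K\cap V_i|$, $1\le i\le n$, is exactly the partition $\sigma$. $s(\sigma)$ denotes the number of parts of $\sigma$ and $\delta$ its smallest part. A $(2,\beta)$-colouring is an assignment of colours to the vertices such that every edge contains at least $2$ and at most $\beta$ distinct colours; a $k$-$(2,\beta)$-colouring is one using exactly $k$ colours. The $(2,\beta)$-spectrum is the set of $k$ for which a $k$-$(2,\beta)$-colouring exists, and $\overline{\chi}_{2,\beta}(H)$ is its maximum. The $(2,\beta)$-monochromatic zone is the set of $k$ for which there is a $k$-$(2,\beta)$-colouring with every class monochromatic; under the hypotheses its largest element is $n$. -}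

module Defs where

open import Data.Nat using (ℕ; zero; suc; _+_; _∸_; _≤_)
open import Data.Nat.Properties using (_≟_)
open import Data.Fin using (Fin)
open import Data.Fin.Subset using (Subset; _∈_; ∣_∣)
open import Data.Fin.Subset.Properties using (_∈?_)
open import Data.Fin.Properties using (any?)
import Data.Fin.Properties as FinP
open import Data.List using (List; length; filter; map; allFin)
open import Data.Nat.ListAction using (sum)
open import Data.List.Relation.Unary.All using (All)
open import Data.List.Membership.Propositional using () renaming (_∈_ to _∈ₗ_)
open import Data.List.Relation.Binary.Permutation.Propositional using (_↭_)
open import Data.Product using (Σ; ∃; _×_; _,_)
open import Relation.Nullary using (¬_)
open import Relation.Nullary.Decidable using (¬?; _×-dec_)
open import Relation.Binary.PropositionalEquality using (_≡_)

IsPartition : List ℕ → ℕ → Set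
IsPartition σ r = All (λ x → 1 ≤ x) σ × sum σ ≡ r

s : List ℕ → ℕ
s = length

IsSmallestPart : List ℕ → ℕ → Set
IsSmallestPart σ δ = δ ∈ₗ σ × All (λ x → δ ≤ x) σ

-- Vertices of H(n,r,q|σ): pairs (i , j) with i : Fin n the class, j : Fin q.
-- A vertex subset K is given by its traces K i ⊆ V_i, i.e. K i : Subset q.
VSet : ℕ → ℕ → Set
VSet n q = Fin n → Subset q

card : ∀ {n q} → VSet n q → ℕ
card {n} K = sum (map (λ i → ∣ K i ∣) (allFin n))

nonzeroCards : ∀ {n q} → VSet n q → List ℕ
nonzeroCards {n} K = filter (λ m → ¬? (m ≟ 0)) (map (λ i → ∣ K i ∣) (allFin n))

IsEdge : ∀ {n q} → ℕ → List ℕ → VSet n q → Set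
IsEdge r σ K = card K ≡ r × nonzeroCards K ↭ σ

Colouring : ℕ → ℕ → ℕ → Set
Colouring n q k = Fin n → Fin q → Fin k

numColours : ∀ {n q k} → Colouring n q k → VSet n q → ℕ
numColours {n} {q} {k} c K =
  length (filter (λ col → any? (λ i → any? (λ j → (j ∈? K i) ×-dec (FinP._≟_ (c i j) col)))) (allFin k))

IsColouring2β : (n r q : ℕ) (σ : List ℕ) (β k : ℕ) → Colouring n q k → Set
IsColouring2β n r q σ β k c =
  (∀ col → ∃ λ i → ∃ λ j → c i j ≡ col) ×
  (∀ (K : VSet n q) → IsEdge r σ K → 2 ≤ numColours c K × numColours c K ≤ β)

InSpectrum : (n r q : ℕ) (σ : List ℕ) (β k : ℕ) → Set
InSpectrum n r q σ β k = Σ (Colouring n q k) (IsColouring2β n r q σ β k)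

IsUpperChromatic : (n r q : ℕ) (σ : List ℕ) (β m : ℕ) → Set
IsUpperChromatic n r q σ β m =
  InSpectrum n r q σ β m × (∀ k → InSpectrum n r q σ β k → k ≤ m)

-- Let c be a (2,β)-colouring with χ̄ colours and give every class V_i a new private colour. For
-- (t, u) running lexicographically from (0, 0) to (n, 0), stage (t, u) paints with its class colour
-- every vertex lying in a class below t, or whose c-colour x < u occurs in no class beyond t. Every
-- stage is again a (2,β)-colouring: an edge meets two classes, so a class colour never is its only
-- colour; if the edge meets a class below t, that class is monochromatic in it, leaving at most
-- 1 + (r - δ) ≤ β colours; otherwise its painted vertices all lie in class t, so on the edge the stage
-- is c followed by a merging of colours. The number of colours is at least χ̄ at the start, at most n
-- at the end, drops by at most one when u grows and does not drop from (t, χ̄) to (t + 1, 0), so it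
-- passes through every k in [n, χ̄]; relabelling the colours used then gives a k-(2,β)-colouring.

module Submission where

open import Defs
open import Data.Nat using (ℕ; zero; suc; _+_; _∸_; _≤_; _<_; z≤n; s≤s; _<?_)
import Data.Nat.Properties as ℕ
open import Data.Nat.ListAction using (sum)
open import Data.Fin using (Fin; zero; suc; toℕ; _↑ˡ_; _↑ʳ_)
import Data.Fin.Properties as Fin
open import Data.Fin.Properties using (any?)
open import Data.Fin.Subset using (Subset; _∈_; ∣_∣; inside; outside; ⊥; Nonempty)
open import Data.Fin.Subset.Properties using (_∈?_; ∣⊥∣≡0; nonempty?; Empty-unique; x∈p⇒∣p-x∣<∣p∣)
open import Data.List using (List; []; _∷_; length; filter; map; allFin; lookup; _++_; concatMap)
open import Data.List.Properties using (length-++; length-++-sucʳ; length-map; length-tabulate; map-cong)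
open import Data.List.Relation.Unary.All as All using (All; _∷_)
open import Data.List.Relation.Unary.Any using (here; there; index)
open import Data.List.Relation.Unary.Any.Properties using (lookup-index)
open import Data.List.Relation.Unary.AllPairs using (_∷_)
open import Data.Vec using ([]; _∷_; here; there)
open import Data.List.Relation.Unary.Unique.Propositional using (Unique)
import Data.List.Relation.Unary.Unique.Propositional.Properties as Unique
open import Data.List.Membership.Propositional using () renaming (_∈_ to _∈ₗ_)
open import Data.List.Membership.Propositional.Properties
  using (∈-∃++; ∈-++⁻; ∈-++⁺ˡ; ∈-++⁺ʳ; ∈-filter⁺; ∈-filter⁻; ∈-allFin; ∈-map⁺; ∈-map⁻; ∈-concat⁺′; ∈-lookup)
open import Data.List.Relation.Binary.Subset.Propositional using (_⊆_)
open import Data.List.Relation.Binary.Permutation.Propositional.Properties using (↭-length; ∈-resp-↭)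
open import Data.Product using (∃; ∃₂; _×_; _,_; proj₁; proj₂)
open import Data.Sum using (_⊎_; inj₁; inj₂)
open import Data.Unit using (⊤; tt)
open import Function using (_∘_)
open import Level using (0ℓ)
open import Algebra.Properties.CommutativeSemigroup ℕ.+-commutativeSemigroup using (interchange)
open import Relation.Nullary using (¬_; Dec; yes; no; does; contradiction)
open import Data.Bool using (if_then_else_)
open import Relation.Nullary.Decidable using (¬?; _×-dec_; _⊎-dec_; decidable-stable)
open import Relation.Unary using (Pred; Decidable)
open import Relation.Binary.PropositionalEquality

private
  variable
    A B : Set
    n q k : ℕ

lookup-injective : {xs : List A} → Unique xs → ∀ a b → lookup xs a ≡ lookup xs b → a ≡ b
lookup-injective {xs = _ ∷ _} _            zero    zero    _  = refl
lookup-injective {xs = _ ∷ _} (x∉ ∷ _)     zero    (suc b) eq = contradiction eq (All.lookup x∉ (∈-lookup b))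
lookup-injective {xs = _ ∷ _} (x∉ ∷ _)     (suc a) zero    eq = contradiction (sym eq) (All.lookup x∉ (∈-lookup a))
lookup-injective {xs = _ ∷ _} (_ ∷ unique) (suc a) (suc b) eq = cong suc (lookup-injective unique a b eq)

unique-⊆⇒length≤ : {xs ys : List A} → Unique xs → xs ⊆ ys → length xs ≤ length ys
unique-⊆⇒length≤ {xs = []}     _             _   = z≤n
unique-⊆⇒length≤ {xs = x ∷ xs} (x∉ ∷ unique) x∷xs⊆ys with ∈-∃++ (x∷xs⊆ys (here refl))
... | ys₁ , ys₂ , refl =
  ℕ.≤-trans (s≤s (unique-⊆⇒length≤ unique xs⊆ys₁++ys₂)) (ℕ.≤-reflexive (sym (length-++-sucʳ ys₁ x ys₂)))
  where
  xs⊆ys₁++ys₂ : xs ⊆ ys₁ ++ ys₂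
  xs⊆ys₁++ys₂ {y} y∈xs with ∈-++⁻ ys₁ (x∷xs⊆ys (there y∈xs))
  ... | inj₁ y∈ys₁         = ∈-++⁺ˡ y∈ys₁
  ... | inj₂ (here y≡x)    = contradiction (sym y≡x) (All.lookup x∉ y∈xs)
  ... | inj₂ (there y∈ys₂) = ∈-++⁺ʳ ys₁ y∈ys₂

unique-constant⇒length≤1 : {xs : List A} → Unique xs → (∀ {a b} → a ∈ₗ xs → b ∈ₗ xs → a ≡ b) → length xs ≤ 1
unique-constant⇒length≤1 {xs = []}         _                 _     = z≤n
unique-constant⇒length≤1 {xs = _ ∷ []}     _                 _     = s≤s z≤n
unique-constant⇒length≤1 {xs = _ ∷ _ ∷ _} ((x≢y ∷ _) ∷ _) const = contradiction (const (here refl) (there (here refl))) x≢y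

∈⇒1≤length : {a : A} {xs : List A} → a ∈ₗ xs → 1 ≤ length xs
∈⇒1≤length {xs = _ ∷ _} _ = s≤s z≤n

distinct-∈⇒2≤length : {a b : A} {xs : List A} → a ∈ₗ xs → b ∈ₗ xs → a ≢ b → 2 ≤ length xs
distinct-∈⇒2≤length (here refl) (here refl) a≢b = contradiction refl a≢b
distinct-∈⇒2≤length (here _)    (there b∈) _   = s≤s (∈⇒1≤length b∈)
distinct-∈⇒2≤length (there a∈)  _          _   = s≤s (∈⇒1≤length a∈)

module _ {P : Pred ℕ 0ℓ} (P? : Decidable P) (f : A → ℕ) where

  1≤length-filter-map : (xs : List A) → 1 ≤ length (filter P? (map f xs)) → ∃ λ a → a ∈ₗ xs × P (f a)
  1≤length-filter-map (x ∷ xs) 1≤len with P? (f x)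
  ... | yes Pfx = x , here refl , Pfx
  ... | no  _   = let a , a∈xs , Pfa = 1≤length-filter-map xs 1≤len in a , there a∈xs , Pfa

  2≤length-filter-map : {xs : List A} → Unique xs → 2 ≤ length (filter P? (map f xs)) →
                        ∃₂ λ a b → a ≢ b × P (f a) × P (f b)
  2≤length-filter-map {xs = x ∷ xs} (x∉ ∷ unique) 2≤len with P? (f x)
  ... | no  _   = 2≤length-filter-map unique 2≤len
  ... | yes Pfx with 2≤len
  ...   | s≤s 1≤len =
    let b , b∈xs , Pfb = 1≤length-filter-map xs 1≤len in x , b , All.lookup x∉ b∈xs , Pfx , Pfb

sum-map-+ : (f g : A → ℕ) (xs : List A) → sum (map (λ x → f x + g x) xs) ≡ sum (map f xs) + sum (map g xs)
sum-map-+ f g []       = refl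
sum-map-+ f g (x ∷ xs) =
  trans (cong (f x + g x +_) (sum-map-+ f g xs)) (interchange (f x) (g x) (sum (map f xs)) (sum (map g xs)))

∈⇒≤sum : {x : ℕ} {xs : List ℕ} → x ∈ₗ xs → x ≤ sum xs
∈⇒≤sum {xs = y ∷ ys} (here refl) = ℕ.m≤m+n y (sum ys)
∈⇒≤sum {xs = y ∷ ys} (there x∈)  = ℕ.≤-trans (∈⇒≤sum x∈) (ℕ.m≤n+m (sum ys) y)

length-concatMap : (g : A → List B) (xs : List A) → length (concatMap g xs) ≡ sum (map (length ∘ g) xs)
length-concatMap g []       = refl
length-concatMap g (x ∷ xs) = trans (length-++ (g x)) (cong (length (g x) +_) (length-concatMap g xs))

elements : Subset q → List (Fin q)
elements []            = []
elements (inside  ∷ p) = zero ∷ map suc (elements p)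
elements (outside ∷ p) = map suc (elements p)

length-elements : (p : Subset q) → length (elements p) ≡ ∣ p ∣
length-elements []            = refl
length-elements (inside  ∷ p) = cong suc (trans (length-map suc (elements p)) (length-elements p))
length-elements (outside ∷ p) = trans (length-map suc (elements p)) (length-elements p)

∈-elements : {p : Subset q} {j : Fin q} → j ∈ p → j ∈ₗ elements p
∈-elements here                          = here refl
∈-elements {p = inside  ∷ p} (there j∈p) = there (∈-map⁺ suc (∈-elements j∈p))
∈-elements {p = outside ∷ p} (there j∈p) = ∈-map⁺ suc (∈-elements j∈p)

∈⇒1≤∣p∣ : {p : Subset q} {j : Fin q} → j ∈ p → 1 ≤ ∣ p ∣
∈⇒1≤∣p∣ j∈p = ℕ.≤-trans (s≤s z≤n) (x∈p⇒∣p-x∣<∣p∣ j∈p)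

∣p∣≢0⇒nonempty : {p : Subset q} → ∣ p ∣ ≢ 0 → Nonempty p
∣p∣≢0⇒nonempty {q = q} {p = p} ∣p∣≢0 with nonempty? p
... | yes nonempty = nonempty
... | no  empty    = contradiction (trans (cong ∣_∣ (Empty-unique empty)) (∣⊥∣≡0 q)) ∣p∣≢0

-- Counting colours

VertexPred : ℕ → ℕ → Set₁
VertexPred n q = Fin n → Fin q → Set

VertexDec : VertexPred n q → Set
VertexDec P = ∀ i j → Dec (P i j)

everywhere? : VertexDec {n} {q} (λ _ _ → ⊤)
everywhere? _ _ = yes tt

_∈ᵛ?_ : (K : VSet n q) → VertexDec (λ i j → j ∈ K i)
(K ∈ᵛ? i) j = j ∈? K i

-- numColours c K is definitionally #colours c (K ∈ᵛ?_).
colours : {P : VertexPred n q} → Colouring n q k → VertexDec P → List (Fin k)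
colours {k = k} c P? = filter (λ x → any? λ i → any? λ j → P? i j ×-dec (c i j Fin.≟ x)) (allFin k)

#colours : {P : VertexPred n q} → Colouring n q k → VertexDec P → ℕ
#colours c P? = length (colours c P?)

module _ {P : VertexPred n q} (P? : VertexDec P) where

  colours-unique : (c : Colouring n q k) → Unique (colours c P?)
  colours-unique {k = k} c = Unique.filter⁺ _ (Unique.allFin⁺ k)

  ∈-colours⁺ : (c : Colouring n q k) {i : Fin n} {j : Fin q} → P i j → c i j ∈ₗ colours c P?
  ∈-colours⁺ c {i} {j} Pij = ∈-filter⁺ _ (∈-allFin _) (i , j , Pij , refl)

  ∈-colours⁻ : (c : Colouring n q k) {x : Fin k} → x ∈ₗ colours c P? → ∃₂ λ i j → P i j × c i j ≡ x
  ∈-colours⁻ c x∈ = proj₂ (∈-filter⁻ _ {xs = allFin _} x∈)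

  #colours≤length : (c : Colouring n q k) (ys : List (Fin k)) →
                    (∀ {i j} → P i j → c i j ∈ₗ ys) → #colours c P? ≤ length ys
  #colours≤length c ys covered = unique-⊆⇒length≤ (colours-unique c) λ x∈ →
    let i , j , Pij , cij≡x = ∈-colours⁻ c x∈ in subst (_∈ₗ ys) cij≡x (covered Pij)

  #colours≤1 : (c : Colouring n q k) →
               (∀ {i j i′ j′} → P i j → P i′ j′ → c i j ≡ c i′ j′) → #colours c P? ≤ 1
  #colours≤1 c constant = unique-constant⇒length≤1 (colours-unique c) λ x∈ y∈ →
    let i , j , Pij , cij≡x = ∈-colours⁻ c x∈ ; i′ , j′ , Pij′ , cij′≡y = ∈-colours⁻ c y∈
    in trans (sym cij≡x) (trans (constant Pij Pij′) cij′≡y)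

  distinct⇒2≤#colours : (c : Colouring n q k) {i i′ : Fin n} {j j′ : Fin q} →
                        P i j → P i′ j′ → c i j ≢ c i′ j′ → 2 ≤ #colours c P?
  distinct⇒2≤#colours c Pij Pij′ = distinct-∈⇒2≤length (∈-colours⁺ c Pij) (∈-colours⁺ c Pij′)

  module _ {k′ : ℕ} (c : Colouring n q k) (e : Colouring n q k′) (φ : Fin k → Fin k′)
           (e≗φ∘c : ∀ {i j} → P i j → e i j ≡ φ (c i j)) where

    #colours-∘ : #colours e P? ≤ #colours c P?
    #colours-∘ = ℕ.≤-trans (#colours≤length e (map φ (colours c P?)) covered)
                           (ℕ.≤-reflexive (length-map φ (colours c P?)))
      where
      covered : ∀ {i j} → P i j → e i j ∈ₗ map φ (colours c P?)
      covered Pij = subst (_∈ₗ _) (sym (e≗φ∘c Pij)) (∈-map⁺ φ (∈-colours⁺ c Pij))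

    #colours-∘-injective : (∀ {x y} → φ x ≡ φ y → x ≡ y) → #colours c P? ≤ #colours e P?
    #colours-∘-injective φ-injective =
      ℕ.≤-trans (ℕ.≤-reflexive (sym (length-map φ (colours c P?))))
                (unique-⊆⇒length≤ (Unique.map⁺ φ-injective (colours-unique c)) image⊆)
      where
      image⊆ : map φ (colours c P?) ⊆ colours e P?
      image⊆ y∈ with ∈-map⁻ φ y∈
      ... | x , x∈ , refl with ∈-colours⁻ c x∈
      ...   | i , j , Pij , refl = subst (_∈ₗ _) (e≗φ∘c Pij) (∈-colours⁺ e Pij)

#colours-⊎ : {P Q R : VertexPred n q} (P? : VertexDec P) (Q? : VertexDec Q) (R? : VertexDec R) (c : Colouring n q k) →
             (∀ {i j} → P i j → Q i j ⊎ R i j) → #colours c P? ≤ #colours c Q? + #colours c R?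
#colours-⊎ {P = P} P? Q? R? c split = ℕ.≤-trans (#colours≤length P? c (colours c Q? ++ colours c R?) covered)
                                             (ℕ.≤-reflexive (length-++ (colours c Q?)))
  where
  covered : ∀ {i j} → P i j → c i j ∈ₗ colours c Q? ++ colours c R?
  covered Pij with split Pij
  ... | inj₁ Qij = ∈-++⁺ˡ (∈-colours⁺ Q? c Qij)
  ... | inj₂ Rij = ∈-++⁺ʳ (colours c Q?) (∈-colours⁺ R? c Rij)

surjective⇒k≤#colours : (c : Colouring n q k) → (∀ x → ∃₂ λ i j → c i j ≡ x) → k ≤ #colours c everywhere?
surjective⇒k≤#colours {k = k} c surjective =
  ℕ.≤-trans (ℕ.≤-reflexive (sym (length-tabulate {n = k} _)))
            (unique-⊆⇒length≤ (Unique.allFin⁺ k) λ {x} _ →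
              let i , j , cij≡x = surjective x in subst (_∈ₗ _) cij≡x (∈-colours⁺ everywhere? c tt))

removeClass : VSet n q → Fin n → VSet n q
removeClass K i i′ = if does (i′ Fin.≟ i) then ⊥ else K i′

∈-removeClass : (K : VSet n q) {i i′ : Fin n} {j : Fin q} → i′ ≢ i → j ∈ K i′ → j ∈ removeClass K i i′
∈-removeClass K {i} {i′} i′≢i j∈ with i′ Fin.≟ i
... | yes i′≡i = contradiction i′≡i i′≢i
... | no  _    = j∈

card-removeClass : (K : VSet n q) (i : Fin n) → card (removeClass K i) + ∣ K i ∣ ≤ card K
card-removeClass {n} {q} K i = begin
  card K′ + ∣ K i ∣                                      ≤⟨ ℕ.+-monoʳ-≤ (card K′) ∣Ki∣≤Σonly ⟩
  card K′ + sum (map only (allFin n))                    ≡⟨ sum-map-+ _ only (allFin n) ⟨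
  sum (map (λ i′ → ∣ K′ i′ ∣ + only i′) (allFin n))      ≡⟨ cong sum (map-cong split (allFin n)) ⟩
  card K                                                 ∎
  where
  open ℕ.≤-Reasoning
  K′ : VSet n q
  K′ = removeClass K i
  only : Fin n → ℕ
  only i′ = if does (i′ Fin.≟ i) then ∣ K i′ ∣ else 0
  ∣Ki∣≤Σonly : ∣ K i ∣ ≤ sum (map only (allFin n))
  ∣Ki∣≤Σonly with i Fin.≟ i | ∈⇒≤sum (∈-map⁺ only (∈-allFin i))
  ... | yes _  | ≤Σ = ≤Σ
  ... | no i≢i | _  = contradiction refl i≢i
  split : ∀ i′ → ∣ K′ i′ ∣ + only i′ ≡ ∣ K i′ ∣
  split i′ with i′ Fin.≟ i
  ... | yes _ = cong (_+ ∣ K i′ ∣) (∣⊥∣≡0 q)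
  ... | no  _ = ℕ.+-identityʳ _

#colours≤card : {P : VertexPred n q} (P? : VertexDec P) (c : Colouring n q k) (K : VSet n q) →
                (∀ {i j} → P i j → j ∈ K i) → #colours c P? ≤ card K
#colours≤card {n} {k = k} {P = P} P? c K P⊆K =
  ℕ.≤-trans (#colours≤length P? c vertexColours covered) (ℕ.≤-reflexive length≡card)
  where
  coloursIn : Fin n → List (Fin k)
  coloursIn i = map (c i) (elements (K i))
  vertexColours : List (Fin k)
  vertexColours = concatMap coloursIn (allFin n)
  covered : ∀ {i j} → P i j → c i j ∈ₗ vertexColours
  covered {i} Pij = ∈-concat⁺′ (∈-map⁺ (c i) (∈-elements (P⊆K Pij))) (∈-map⁺ coloursIn (∈-allFin i))
  length≡card : length vertexColours ≡ card K
  length≡card = trans (length-concatMap coloursIn (allFin n))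
                      (cong sum (map-cong (λ i → trans (length-map (c i) (elements (K i))) (length-elements (K i))) (allFin n)))

-- Edges of H(n,r,q|σ)

module _ {σ : List ℕ} {r : ℕ} {K : VSet n q} (edge : IsEdge r σ K) where

  edge-meets-two-classes : 2 ≤ s σ → ∃₂ λ i i′ → i ≢ i′ × Nonempty (K i) × Nonempty (K i′)
  edge-meets-two-classes 2≤sσ =
    let i , i′ , i≢i′ , Ki≢0 , Ki′≢0 = 2≤length-filter-map (λ m → ¬? (m ℕ.≟ 0)) (λ i → ∣ K i ∣)
                                         (Unique.allFin⁺ n) (subst (2 ≤_) (sym (↭-length (proj₂ edge))) 2≤sσ)
    in i , i′ , i≢i′ , ∣p∣≢0⇒nonempty Ki≢0 , ∣p∣≢0⇒nonempty Ki′≢0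

  edge-class-size : {δ : ℕ} → All (δ ≤_) σ → {i : Fin n} {j : Fin q} → j ∈ K i → δ ≤ ∣ K i ∣
  edge-class-size δ≤σ {i} j∈Ki = All.lookup δ≤σ (∈-resp-↭ (proj₂ edge) ∣Ki∣∈nonzeroCards)
    where
    ∣Ki∣∈nonzeroCards : ∣ K i ∣ ∈ₗ nonzeroCards K
    ∣Ki∣∈nonzeroCards = ∈-filter⁺ _ (∈-map⁺ (λ i → ∣ K i ∣) (∈-allFin i))
                                   (λ ∣Ki∣≡0 → ℕ.<⇒≢ (∈⇒1≤∣p∣ j∈Ki) (sym ∣Ki∣≡0))

  #colours≤β-of-monochromatic-class :
    {δ β : ℕ} → All (δ ≤_) σ → r ∸ β + 1 ≤ δ → (c : Colouring n q k) {i : Fin n} {j₀ : Fin q} → j₀ ∈ K i →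
    (∀ {j j′} → j ∈ K i → j′ ∈ K i → c i j ≡ c i j′) → #colours c (K ∈ᵛ?_) ≤ β
  #colours≤β-of-monochromatic-class {δ = δ} {β = β} δ≤σ r∸β<δ c {i} j₀∈Ki monochromatic =
    -- r ∸ β is added on both sides so that no truncated subtraction has to be reasoned about.
    ℕ.+-cancelʳ-≤ (r ∸ β) _ β (begin
      #colours c (K ∈ᵛ?_) + (r ∸ β)              ≤⟨ ℕ.+-monoˡ-≤ (r ∸ β) split-bound ⟩
      card K′ + 1 + (r ∸ β)                       ≡⟨ ℕ.+-assoc (card K′) 1 (r ∸ β) ⟩
      card K′ + (1 + (r ∸ β))                     ≤⟨ ℕ.+-monoʳ-≤ (card K′) 1+r∸β≤∣Ki∣ ⟩
      card K′ + ∣ K i ∣                            ≤⟨ card-removeClass K i ⟩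
      card K                                      ≡⟨ proj₁ edge ⟩
      r                                           ≤⟨ ℕ.m≤n+m∸n r β ⟩
      β + (r ∸ β)                                 ∎)
    where
    open ℕ.≤-Reasoning
    K′ : VSet n q
    K′ = removeClass K i
    inClass? : VertexDec (λ i′ j → i′ ≡ i × j ∈ K i′)
    inClass? i′ j = (i′ Fin.≟ i) ×-dec (j ∈? K i′)
    split : ∀ {i′ j} → j ∈ K i′ → j ∈ K′ i′ ⊎ (i′ ≡ i × j ∈ K i′)
    split {i′} {j} j∈ = by-class (i′ Fin.≟ i)
      where
      by-class : Dec (i′ ≡ i) → j ∈ K′ i′ ⊎ (i′ ≡ i × j ∈ K i′)
      by-class (yes i′≡i) = inj₂ (i′≡i , j∈)
      by-class (no  i′≢i) = inj₁ (∈-removeClass K i′≢i j∈)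
    split-bound : #colours c (K ∈ᵛ?_) ≤ card K′ + 1
    split-bound = ℕ.≤-trans (#colours-⊎ (K ∈ᵛ?_) (K′ ∈ᵛ?_) inClass? c split)
                    (ℕ.+-mono-≤ (#colours≤card (K′ ∈ᵛ?_) c K′ λ j∈ → j∈)
                                (#colours≤1 inClass? c λ { (refl , j∈) (refl , j′∈) → monochromatic j∈ j′∈ }))
    1+r∸β≤∣Ki∣ : 1 + (r ∸ β) ≤ ∣ K i ∣
    1+r∸β≤∣Ki∣ = ℕ.≤-trans (ℕ.≤-reflexive (ℕ.+-comm 1 (r ∸ β))) (ℕ.≤-trans r∸β<δ (edge-class-size δ≤σ j₀∈Ki))

Is2βOnEdges : ℕ → List ℕ → ℕ → Colouring n q k → Set
Is2βOnEdges r σ β c = ∀ K → IsEdge r σ K → 2 ≤ numColours c K × numColours c K ≤ β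

module _ {r β : ℕ} {σ : List ℕ} {M : ℕ} (e : Colouring n q M) where

  private
    U : List (Fin M)
    U = colours e everywhere?

  inSpectrum-#colours : Is2βOnEdges r σ β e → InSpectrum n r q σ β (#colours e everywhere?)
  inSpectrum-#colours e-2β = e′ , surjective , λ K edge →
      ℕ.≤-trans (proj₁ (e-2β K edge)) (#colours-∘ (K ∈ᵛ?_) e′ e (lookup U) (λ _ → lookup-e′))
    , ℕ.≤-trans (#colours-∘-injective (K ∈ᵛ?_) e′ e (lookup U) (λ _ → lookup-e′) (lookup-injective (colours-unique everywhere? e) _ _))
                (proj₂ (e-2β K edge))
    where
    e′ : Colouring n q (length U)
    e′ i j = index (∈-colours⁺ everywhere? e {i} {j} tt)
    lookup-e′ : ∀ {i j} → e i j ≡ lookup U (e′ i j)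
    lookup-e′ = lookup-index (∈-colours⁺ everywhere? e tt)
    surjective : ∀ a → ∃₂ λ i j → e′ i j ≡ a
    surjective a = let i , j , _ , eij≡ = ∈-colours⁻ everywhere? e (∈-lookup a) in
      i , j , lookup-injective (colours-unique everywhere? e) _ _ (trans (sym lookup-e′) eij≡)

-- Interpolating between c and the class colouring

discrete-ivt : (g : ℕ → ℕ) (N k : ℕ) → (∀ s → g s ≤ suc (g (suc s))) → g N ≤ k → k ≤ g 0 → ∃ λ s → g s ≡ k
discrete-ivt g zero    k _    gN≤k k≤g0 = 0 , ℕ.≤-antisym gN≤k k≤g0
discrete-ivt g (suc N) k step gN≤k k≤g0 with k ℕ.≤? g 1
... | yes k≤g1 = let s , gs≡k = discrete-ivt (g ∘ suc) N k (step ∘ suc) gN≤k k≤g1 in suc s , gs≡k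
... | no  k≰g1 = 0 , ℕ.≤-antisym (ℕ.≤-trans (step 0) (ℕ.≰⇒> k≰g1)) k≤g0

discrete-ivt-lex : (g : ℕ → ℕ → ℕ) (T U k : ℕ) → (∀ t u → g t u ≤ suc (g t (suc u))) →
                   (∀ t → g t U ≤ g (suc t) 0) → g T 0 ≤ k → k ≤ g 0 0 → ∃₂ λ t u → g t u ≡ k
discrete-ivt-lex g zero    U k _    _    gT≤k k≤g00 = 0 , 0 , ℕ.≤-antisym gT≤k k≤g00
discrete-ivt-lex g (suc T) U k step next gT≤k k≤g00 with k ℕ.≤? g 1 0
... | yes k≤g10 = let t , u , gtu≡k = discrete-ivt-lex (g ∘ suc) T U k (step ∘ suc) (next ∘ suc) gT≤k k≤g10
                  in suc t , u , gtu≡k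
... | no  k≰g10 = let u , g0u≡k = discrete-ivt (g 0) U k (step 0) gU≤k k≤g00 in 0 , u , g0u≡k
  where
  gU≤k : g 0 U ≤ k
  gU≤k = ℕ.≤-trans (next 0) (ℕ.<⇒≤ (ℕ.≰⇒> k≰g10))

module Recolouring {m : ℕ} (c : Colouring n q m) where

  Survives : ℕ → Fin m → Set
  Survives t x = ∃₂ λ i j → t < toℕ i × c i j ≡ x

  survives? : ∀ t x → Dec (Survives t x)
  survives? t x = any? λ i → any? λ j → (t <? toℕ i) ×-dec (c i j Fin.≟ x)

  Gone : ℕ → ℕ → Fin m → Set
  Gone t u x = ¬ Survives t x × toℕ x < u

  gone? : ∀ t u x → Dec (Gone t u x)
  gone? t u x = ¬? (survives? t x) ×-dec (toℕ x <? u)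

  Recoloured : ℕ → ℕ → VertexPred n q
  Recoloured t u i j = toℕ i < t ⊎ Gone t u (c i j)

  recoloured? : ∀ t u → VertexDec (Recoloured t u)
  recoloured? t u i j = (toℕ i <? t) ⊎-dec gone? t u (c i j)

  classColour : Fin n → Fin (n + m)
  classColour i = i ↑ˡ m

  oldColour : Fin m → Fin (n + m)
  oldColour x = n ↑ʳ x

  classColour≢oldColour : ∀ {i x} → classColour i ≢ oldColour x
  classColour≢oldColour {i} {x} eq = ℕ.<⇒≢ (ℕ.<-≤-trans (Fin.toℕ<n i) (ℕ.m≤m+n n (toℕ x))) (begin
    toℕ i                ≡⟨ Fin.toℕ-↑ˡ i m ⟨
    toℕ (classColour i)  ≡⟨ cong toℕ eq ⟩
    toℕ (oldColour x)    ≡⟨ Fin.toℕ-↑ʳ n x ⟩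
    n + toℕ x            ∎)
    where open ≡-Reasoning

  ¬survives⇒class≤ : ∀ {t i j} → ¬ Survives t (c i j) → toℕ i ≤ t
  ¬survives⇒class≤ {i = i} {j} ¬surv = ℕ.≮⇒≥ λ t<i → ¬surv (i , j , t<i , refl)

  recolour : ℕ → ℕ → Colouring n q (n + m)
  recolour t u i j with recoloured? t u i j
  ... | yes _ = classColour i
  ... | no  _ = oldColour (c i j)

  module _ {t u : ℕ} {i : Fin n} {j : Fin q} where

    recolour-recoloured : Recoloured t u i j → recolour t u i j ≡ classColour i
    recolour-recoloured rec with recoloured? t u i j
    ... | yes _     = refl
    ... | no  ¬rec  = contradiction rec ¬rec

    recolour-kept : ¬ Recoloured t u i j → recolour t u i j ≡ oldColour (c i j)
    recolour-kept ¬rec with recoloured? t u i j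
    ... | yes rec = contradiction rec ¬rec
    ... | no  _   = refl

    recolour-other-class : ∀ {i′} → i′ ≢ i → classColour i′ ≢ recolour t u i j
    recolour-other-class {i′} i′≢i eq with recoloured? t u i j
    ... | yes _ = i′≢i (Fin.↑ˡ-injective m i′ i eq)
    ... | no  _ = classColour≢oldColour eq

  recoloured⇒class<suc : ∀ {t u i j} → Recoloured t u i j → toℕ i < suc t
  recoloured⇒class<suc (inj₁ i<t)        = ℕ.m<n⇒m<1+n i<t
  recoloured⇒class<suc (inj₂ (¬surv , _)) = s≤s (¬survives⇒class≤ ¬surv)

  recoloured-suc : ∀ {t u i j} → Recoloured t u i j → Recoloured t (suc u) i j
  recoloured-suc (inj₁ i<t)           = inj₁ i<t
  recoloured-suc (inj₂ (¬surv , x<u)) = inj₂ (¬surv , ℕ.m<n⇒m<1+n x<u)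

  changed⇒kept-with-colour : ∀ {t u i j} → recolour t u i j ≢ recolour t (suc u) i j →
                             recolour t u i j ≡ oldColour (c i j) × toℕ (c i j) ≡ u
  changed⇒kept-with-colour {t} {u} {i} {j} changed = recolour-kept ¬rec , colour≡u rec′
    where
    ¬rec : ¬ Recoloured t u i j
    ¬rec rec = changed (trans (recolour-recoloured rec) (sym (recolour-recoloured (recoloured-suc rec))))
    rec′ : Recoloured t (suc u) i j
    rec′ = decidable-stable (recoloured? t (suc u) i j) λ ¬rec′ →
      changed (trans (recolour-kept ¬rec) (sym (recolour-kept ¬rec′)))
    colour≡u : Recoloured t (suc u) i j → toℕ (c i j) ≡ u
    colour≡u (inj₁ i<t)              = contradiction (inj₁ i<t) ¬rec
    colour≡u (inj₂ (¬surv , x<1+u)) = ℕ.≤-antisym (ℕ.≤-pred x<1+u) (ℕ.≮⇒≥ λ x<u → ¬rec (inj₂ (¬surv , x<u)))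

  #recolour : ℕ → ℕ → ℕ
  #recolour t u = #colours (recolour t u) everywhere?

  #recolour-start : (∀ x → ∃₂ λ i j → c i j ≡ x) → m ≤ #recolour 0 0
  #recolour-start surjective =
    ℕ.≤-trans (surjective⇒k≤#colours c surjective)
              (#colours-∘-injective everywhere? c (recolour 0 0) oldColour (λ _ → recolour-kept nothing-recoloured)
                                    (Fin.↑ʳ-injective n _ _))
    where
    nothing-recoloured : ∀ {i j} → ¬ Recoloured 0 0 i j
    nothing-recoloured (inj₁ ())
    nothing-recoloured (inj₂ (_ , ()))

  #recolour-end : #recolour n 0 ≤ n
  #recolour-end = ℕ.≤-trans (#colours≤length everywhere? (recolour n 0) (map classColour (allFin n)) covered)
                            (ℕ.≤-reflexive (trans (length-map classColour (allFin n)) (length-tabulate {n = n} _)))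
    where
    covered : ∀ {i j} → ⊤ → recolour n 0 i j ∈ₗ map classColour (allFin n)
    covered {i} _ = subst (_∈ₗ _) (sym (recolour-recoloured (inj₁ (Fin.toℕ<n i)))) (∈-map⁺ classColour (∈-allFin i))

  #recolour-step : ∀ t u → #recolour t u ≤ suc (#recolour t (suc u))
  #recolour-step t u = ℕ.≤-trans (#colours-⊎ everywhere? changed? unchanged? (recolour t u) split)
                                 (ℕ.+-mono-≤ (#colours≤1 changed? (recolour t u) same-colour)
                                             (#colours≤length unchanged? (recolour t u) _ covered))
    where
    changed? : VertexDec (λ i j → recolour t u i j ≢ recolour t (suc u) i j)
    changed? i j = ¬? (recolour t u i j Fin.≟ recolour t (suc u) i j)
    unchanged? : VertexDec (λ i j → recolour t u i j ≡ recolour t (suc u) i j)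
    unchanged? i j = recolour t u i j Fin.≟ recolour t (suc u) i j
    split : ∀ {i j} → ⊤ → recolour t u i j ≢ recolour t (suc u) i j ⊎ recolour t u i j ≡ recolour t (suc u) i j
    split {i} {j} _ with unchanged? i j
    ... | yes same = inj₂ same
    ... | no  diff = inj₁ diff
    same-colour : ∀ {i j i′ j′} → recolour t u i j ≢ recolour t (suc u) i j →
                  recolour t u i′ j′ ≢ recolour t (suc u) i′ j′ → recolour t u i j ≡ recolour t u i′ j′
    same-colour {i} {j} {i′} {j′} changed changed′ =
      let eq , x≡u = changed⇒kept-with-colour {t} {u} {i} {j} changed
          eq′ , x′≡u = changed⇒kept-with-colour {t} {u} {i′} {j′} changed′
      in trans eq (trans (cong oldColour (Fin.toℕ-injective (trans x≡u (sym x′≡u)))) (sym eq′))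
    covered : ∀ {i j} → recolour t u i j ≡ recolour t (suc u) i j → recolour t u i j ∈ₗ colours (recolour t (suc u)) everywhere?
    covered same = subst (_∈ₗ _) (sym same) (∈-colours⁺ everywhere? (recolour t (suc u)) tt)

  #recolour-next-class : ∀ t → #recolour t m ≤ #recolour (suc t) 0
  #recolour-next-class t = #colours≤length everywhere? (recolour t m) _ λ {i} {j} _ → covered (recoloured? t m i j)
    where
    next : Colouring n q (n + m)
    next = recolour (suc t) 0
    covered : ∀ {i j} → Dec (Recoloured t m i j) → recolour t m i j ∈ₗ colours next everywhere?
    covered {i} {j} (yes rec) =
      subst (_∈ₗ _) (trans (recolour-recoloured (inj₁ (recoloured⇒class<suc rec))) (sym (recolour-recoloured rec)))
            (∈-colours⁺ everywhere? next {i} {j} tt)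
    covered {i} {j} (no ¬rec) with decidable-stable (survives? t (c i j)) (λ ¬surv → ¬rec (inj₂ (¬surv , Fin.toℕ<n _)))
    ... | i′ , j′ , t<i′ , c′≡c = subst (_∈ₗ _) (trans (recolour-kept ¬rec′) (trans (cong oldColour c′≡c) (sym (recolour-kept ¬rec))))
                                        (∈-colours⁺ everywhere? next {i′} {j′} tt)
      where
      ¬rec′ : ¬ Recoloured (suc t) 0 i′ j′
      ¬rec′ (inj₁ i′<1+t)  = ℕ.<⇒≱ t<i′ (ℕ.≤-pred i′<1+t)
      ¬rec′ (inj₂ (_ , ()))

  module _ {σ : List ℕ} {r δ β : ℕ} (δ≤σ : All (δ ≤_) σ) (r∸β<δ : r ∸ β + 1 ≤ δ) (2≤sσ : 2 ≤ s σ)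
           (c-2β : Is2βOnEdges r σ β c) (t u : ℕ) {K : VSet n q} (edge : IsEdge r σ K) where

    module _ {i₁ : Fin n} {j₁ : Fin q} (j₁∈ : j₁ ∈ K i₁) (rec₁ : Recoloured t u i₁ j₁) where

      2≤#colours-recoloured-edge : 2 ≤ #colours (recolour t u) (K ∈ᵛ?_)
      2≤#colours-recoloured-edge with edge-meets-two-classes edge 2≤sσ
      ... | i , i′ , i≢i′ , (j , j∈) , (j′ , j′∈) with i₁ Fin.≟ i
      ...   | yes refl = distinct⇒2≤#colours (K ∈ᵛ?_) (recolour t u) j₁∈ j′∈
                           λ eq → recolour-other-class {t} {u} {i′} {j′} i≢i′ (trans (sym (recolour-recoloured rec₁)) eq)
      ...   | no  i₁≢i = distinct⇒2≤#colours (K ∈ᵛ?_) (recolour t u) j₁∈ j∈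
                           λ eq → recolour-other-class {t} {u} {i} {j} i₁≢i (trans (sym (recolour-recoloured rec₁)) eq)

      #colours≤β-recoloured-edge : #colours (recolour t u) (K ∈ᵛ?_) ≤ β
      #colours≤β-recoloured-edge with any? (λ i → any? λ j → (j ∈? K i) ×-dec (toℕ i <? t))
      ... | yes (i₀ , j₀ , j₀∈ , i₀<t) =
        #colours≤β-of-monochromatic-class edge δ≤σ r∸β<δ (recolour t u) j₀∈
          λ _ _ → trans (recolour-recoloured (inj₁ i₀<t)) (sym (recolour-recoloured (inj₁ i₀<t)))
      ... | no none-below = ℕ.≤-trans (#colours-∘ (K ∈ᵛ?_) c (recolour t u) paint agrees) (proj₂ (c-2β K edge))
        where
        class≡t : ∀ {i j} → j ∈ K i → Recoloured t u i j → toℕ i ≡ t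
        class≡t {i} {j} j∈ rec =
          ℕ.≤-antisym (ℕ.≤-pred (recoloured⇒class<suc rec)) (ℕ.≮⇒≥ λ i<t → none-below (i , j , j∈ , i<t))
        -- No class below t meets K, so the painted vertices of K all lie in i₁, the class of index t.
        paint : Fin m → Fin (n + m)
        paint x with gone? t u x
        ... | yes _ = classColour i₁
        ... | no  _ = oldColour x
        paint-gone : ∀ {x} → Gone t u x → paint x ≡ classColour i₁
        paint-gone {x} gone with gone? t u x
        ... | yes _     = refl
        ... | no  ¬gone = contradiction gone ¬gone
        paint-kept : ∀ {x} → ¬ Gone t u x → paint x ≡ oldColour x
        paint-kept {x} ¬gone with gone? t u x
        ... | yes gone = contradiction gone ¬gone
        ... | no  _    = refl
        agrees : ∀ {i j} → j ∈ K i → recolour t u i j ≡ paint (c i j)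
        agrees {i} {j} j∈ = by-gone (gone? t u (c i j))
          where
          by-gone : Dec (Gone t u (c i j)) → recolour t u i j ≡ paint (c i j)
          by-gone (yes gone) = begin
            recolour t u i j  ≡⟨ recolour-recoloured (inj₂ gone) ⟩
            classColour i     ≡⟨ cong classColour (Fin.toℕ-injective (trans (class≡t j∈ (inj₂ gone)) (sym (class≡t j₁∈ rec₁)))) ⟩
            classColour i₁    ≡⟨ paint-gone gone ⟨
            paint (c i j)     ∎
            where open ≡-Reasoning
          by-gone (no ¬gone) = trans (recolour-kept λ { (inj₁ i<t) → none-below (i , j , j∈ , i<t) ; (inj₂ gone) → ¬gone gone })
                                     (sym (paint-kept ¬gone))

    recolour-2β-on-edge : 2 ≤ #colours (recolour t u) (K ∈ᵛ?_) × #colours (recolour t u) (K ∈ᵛ?_) ≤ β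
    recolour-2β-on-edge with any? (λ i → any? λ j → (j ∈? K i) ×-dec recoloured? t u i j)
    ... | yes (i₁ , j₁ , j₁∈ , rec₁) = 2≤#colours-recoloured-edge j₁∈ rec₁ , #colours≤β-recoloured-edge j₁∈ rec₁
    ... | no  none =
        ℕ.≤-trans (proj₁ (c-2β K edge)) (#colours-∘-injective (K ∈ᵛ?_) c (recolour t u) oldColour kept (Fin.↑ʳ-injective n _ _))
      , ℕ.≤-trans (#colours-∘ (K ∈ᵛ?_) c (recolour t u) oldColour kept) (proj₂ (c-2β K edge))
      where
      kept : ∀ {i j} → j ∈ K i → recolour t u i j ≡ oldColour (c i j)
      kept {i} {j} j∈ = recolour-kept λ rec → none (i , j , j∈ , rec)

proposition4p3 : (σ : List ℕ) (r δ n q β : ℕ) →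
    1 ≤ r → IsPartition σ r → IsSmallestPart σ δ →
    1 ≤ n → 1 ≤ q →
    2 ≤ s σ → s σ ≤ β → r ∸ β + 1 ≤ δ →
    (χ̄ : ℕ) → IsUpperChromatic n r q σ β χ̄ →
    (k : ℕ) → n ≤ k → k ≤ χ̄ → InSpectrum n r q σ β k
proposition4p3 σ r δ n q β _ _ (_ , δ≤σ) _ _ 2≤sσ _ r∸β<δ χ̄ ((c , surjective , c-2β) , _) k n≤k k≤χ̄ =
  let t , u , #recolour≡k = discrete-ivt-lex #recolour n χ̄ k #recolour-step #recolour-next-class
                              (ℕ.≤-trans #recolour-end n≤k) (ℕ.≤-trans k≤χ̄ (#recolour-start surjective))
  in subst (InSpectrum n r q σ β) #recolour≡k
       (inSpectrum-#colours (recolour t u) λ K edge → recolour-2β-on-edge δ≤σ r∸β<δ 2≤sσ c-2β t u edge)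
  where open Recolouring c
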